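{- Let $\theta^{(1)}_\nu(x)=\sum_{n\ge0}\frac{(-1)^n(1-q)^{2n}x^n}{(q;q)_n(q^{\nu+1};q)_n}$ and define $\mu^{(1)}_n(q)$ by $\frac{\theta^{(1)}_{\nu+1}(x)}{\theta^{(1)}_\nu(x)}=\sum_{n\ge0}\mu^{(1)}_n(q)x^n$. Then $\mu^{(1)}_0(q)=1$ and for $n\ge 1$, \[ q^{ -\nu-1}[\nu+1]_q[\nu+n+1]_q\mu^{(1)}_{n}(q)=\sum_{k=0}^{n-1} q^{k}\mu^{(1)}_{k}(q)\mu^{(1)}_{n-k-1}(q). \]
   Context: $(a;q)_n=(1-a)(1-aq)\cdots(1-aq^{n-1})$ and $[x]_q=(1-q^x)/(1-q)$. Here $\nu$ is a parameter (not a negative integer). -}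

module Defs where

open import Level using (Level; suc; _⊔_)
open import Data.Nat using (ℕ; zero; suc)
open import Relation.Nullary using (¬_)
open import Algebra.Bundles using (CommutativeRing)

record Field (c ℓ : Level) : Set (Level.suc (c ⊔ ℓ)) where
  field
    commutativeRing : CommutativeRing c ℓ
  open CommutativeRing commutativeRing public
  field
    _⁻¹     : Carrier → Carrier
    1≉0     : ¬ (1# ≈ 0#)
    inverse : ∀ x → ¬ (x ≈ 0#) → x * (x ⁻¹) ≈ 1#

module FieldDefs {c ℓ : Level} (K : Field c ℓ) where
  open Field K

  pow : Carrier → ℕ → Carrier
  pow x zero    = 1#
  pow x (suc n) = x * pow x n

  sumBelow : ℕ → (ℕ → Carrier) → Carrier
  sumBelow zero    f = 0#
  sumBelow (suc n) f = sumBelow n f + f n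

  qPoch : Carrier → Carrier → ℕ → Carrier
  qPoch a q zero    = 1#
  qPoch a q (suc n) = qPoch a q n * (1# - a * pow q n)

  -- n-th coefficient of θ^{(1)}_ν(x), where t stands for q^ν:
  --   (-1)^n (1-q)^{2n} / ((q;q)_n (q^{ν+1};q)_n),   q^{ν+1} = t q
  thetaCoeff : Carrier → Carrier → ℕ → Carrier
  thetaCoeff q t n =
    pow (- 1#) n * pow (1# - q) (2 Data.Nat.* n)
      * ((qPoch q q n * qPoch (t * q) q n) ⁻¹)

  -- q-number [ν+m]_q = (1 - q^{ν+m})/(1-q) with t = q^ν
  qNum : Carrier → Carrier → ℕ → Carrier
  qNum q t m = (1# - t * pow q m) * ((1# - q) ⁻¹)

-- Write s = q^{ν+1}, θ = θ_ν, θ₊ = θ_{ν+1} and μ = θ₊/θ.  Comparing coefficients of the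
-- explicit series gives the contiguity relation (1 - s) θ(x) = θ₊(x) - s θ₊(qx) and the
-- q-difference equation (1 - q)² x θ₊(x) = (1 - s) (θ(qx) - θ(x)).  Together they say that
-- μ solves the q-Riccati equation
--   (1 - s) μ(x) = s (1 - s) μ(qx) + s (1 - q)² x μ(x) μ(qx) + (1 - s)²,
-- which is checked after multiplying by θ (a power series with constant term 1, hence
-- cancellable).  Its coefficient of x^{n+1} is the recurrence.

module Submission where

open import Defs
open import Level using (Level)
open import Data.Nat using (ℕ; zero; suc; _∸_; _≥_; _≤_; _<_; z≤n; s≤s)
import Data.Nat as ℕ
open import Data.Nat.Induction using (<-rec)
open import Data.Nat.Properties using (n∸n≡0; +-∸-assoc; m≤n⇒m≤1+n; +-suc; ≤-refl)
open import Data.Product using (_×_; _,_)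
open import Relation.Binary.Bundles using (Setoid)
open import Relation.Binary.Core using (Rel)
open import Relation.Nullary using (¬_)
import Relation.Binary.PropositionalEquality as ≡
import Relation.Binary.Reasoning.Setoid as SetoidReasoning
import Algebra.Properties.Ring as RingProperties
import Algebra.Solver.Ring.NaturalCoefficients.Default as NaturalCoefficients

module FieldProperties {r ℓ : Level} (K : Field r ℓ) where
  open Field K
  open SetoidReasoning setoid
  open RingProperties ring using (-1*x≈-x; ⁻¹-anti-homo‿-; //-rightDividesˡ)
  open NaturalCoefficients commutativeSemiring using (solve; _:=_; _:*_)

  [1-x]*y+x*y≈y : ∀ x y → (1# - x) * y + x * y ≈ y
  [1-x]*y+x*y≈y x y = begin
    (1# - x) * y + x * y  ≈⟨ distribʳ y (1# - x) x ⟨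
    (1# - x + x) * y      ≈⟨ *-congʳ (//-rightDividesˡ x 1#) ⟩
    1# * y                ≈⟨ *-identityˡ y ⟩
    y                     ∎

  [x-1]*y+y≈x*y : ∀ x y → (x - 1#) * y + y ≈ x * y
  [x-1]*y+y≈x*y x y = begin
    (x - 1#) * y + y       ≈⟨ +-congˡ (*-identityˡ y) ⟨
    (x - 1#) * y + 1# * y  ≈⟨ distribʳ y (x - 1#) 1# ⟨
    (x - 1# + 1#) * y      ≈⟨ *-congʳ (//-rightDividesˡ 1# x) ⟩
    x * y                  ∎

  [x-1]*-1≈1-x : ∀ x → (x - 1#) * - 1# ≈ 1# - x
  [x-1]*-1≈1-x x = begin
    (x - 1#) * - 1#  ≈⟨ *-comm (x - 1#) (- 1#) ⟩
    - 1# * (x - 1#)  ≈⟨ -1*x≈-x (x - 1#) ⟩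
    - (x - 1#)       ≈⟨ ⁻¹-anti-homo‿- x 1# ⟩
    1# - x           ∎

  ≉0-resp-≈ : ∀ {x y} → x ≈ y → ¬ x ≈ 0# → ¬ y ≈ 0#
  ≉0-resp-≈ x≈y x≉0 y≈0 = x≉0 (trans x≈y y≈0)

  ⁻¹-cancelˡ : ∀ {x} → ¬ x ≈ 0# → ∀ y → x ⁻¹ * (x * y) ≈ y
  ⁻¹-cancelˡ {x} x≉0 y = begin
    x ⁻¹ * (x * y)  ≈⟨ *-assoc (x ⁻¹) x y ⟨
    x ⁻¹ * x * y    ≈⟨ *-congʳ (trans (*-comm (x ⁻¹) x) (inverse x x≉0)) ⟩
    1# * y          ≈⟨ *-identityˡ y ⟩
    y               ∎

  *-≉0 : ∀ {x y} → ¬ x ≈ 0# → ¬ y ≈ 0# → ¬ x * y ≈ 0#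
  *-≉0 {x} {y} x≉0 y≉0 xy≈0 = y≉0 (begin
    y               ≈⟨ ⁻¹-cancelˡ x≉0 y ⟨
    x ⁻¹ * (x * y)  ≈⟨ *-congˡ xy≈0 ⟩
    x ⁻¹ * 0#       ≈⟨ zeroʳ (x ⁻¹) ⟩
    0#              ∎)

  cross-multiply : ∀ {a b x y} → ¬ x ≈ 0# → ¬ y ≈ 0# →
                   a * y ≈ b * x → a * x ⁻¹ ≈ b * y ⁻¹
  cross-multiply {a} {b} {x} {y} x≉0 y≉0 ay≈bx = begin
    a * x ⁻¹                 ≈⟨ *-identityʳ (a * x ⁻¹) ⟨
    a * x ⁻¹ * 1#            ≈⟨ *-congˡ (inverse y y≉0) ⟨
    a * x ⁻¹ * (y * y ⁻¹)    ≈⟨ rearrange a y (x ⁻¹) (y ⁻¹) ⟩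
    a * y * (x ⁻¹ * y ⁻¹)    ≈⟨ *-congʳ ay≈bx ⟩
    b * x * (x ⁻¹ * y ⁻¹)    ≈⟨ rearrange′ b x (x ⁻¹) (y ⁻¹) ⟩
    x * x ⁻¹ * (b * y ⁻¹)    ≈⟨ *-congʳ (inverse x x≉0) ⟩
    1# * (b * y ⁻¹)          ≈⟨ *-identityˡ (b * y ⁻¹) ⟩
    b * y ⁻¹                 ∎
    where
    rearrange : ∀ a y xi yi → a * xi * (y * yi) ≈ a * y * (xi * yi)
    rearrange = solve 4 (λ a y xi yi → a :* xi :* (y :* yi) := a :* y :* (xi :* yi)) refl
    rearrange′ : ∀ b x xi yi → b * x * (xi * yi) ≈ x * xi * (b * yi)
    rearrange′ = solve 4 (λ b x xi yi → b :* x :* (xi :* yi) := x :* xi :* (b :* yi)) refl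

module PowerSeries {r ℓ : Level} (K : Field r ℓ) where
  open Field K
  open FieldDefs K using (pow; sumBelow)
  open RingProperties ring using (+-cancelʳ)
  open NaturalCoefficients commutativeSemiring using (solve; _:=_; _:+_; _:*_)

  Series : Set r
  Series = ℕ → Carrier

  infix 4 _≋_
  _≋_ : Rel Series ℓ
  f ≋ g = ∀ n → f n ≈ g n

  ≋-setoid : Setoid r ℓ
  ≋-setoid = record
    { Carrier       = Series
    ; _≈_           = _≋_
    ; isEquivalence = record
      { refl  = λ _ → refl
      ; sym   = λ f≋g n → sym (f≋g n)
      ; trans = λ f≋g g≋h n → trans (f≋g n) (g≋h n)
      }
    }

  open Setoid ≋-setoid public using () renaming (refl to ≋-refl; sym to ≋-sym; trans to ≋-trans)

  infixl 6 _⊕_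
  infixl 7 _⊙_
  infixr 7 _•_

  _⊕_ : Series → Series → Series
  (f ⊕ g) n = f n + g n

  _•_ : Carrier → Series → Series
  (a • f) n = a * f n

  𝟙 : Series
  𝟙 zero    = 1#
  𝟙 (suc _) = 0#

  tail : Series → Series
  tail f n = f (suc n)

  shift : Series → Series
  shift f zero    = 0#
  shift f (suc n) = f n

  dilate : Carrier → Series → Series
  dilate q f n = pow q n * f n

  -- the Cauchy product, by recursion on the first factor:  f g = f₀ g + x (tail f) g
  _⊙_ : Series → Series → Series
  (f ⊙ g) zero    = f 0 * g 0
  (f ⊙ g) (suc n) = f 0 * g (suc n) + (tail f ⊙ g) n

  ⊕-cong : ∀ {f f′ g g′} → f ≋ f′ → g ≋ g′ → f ⊕ g ≋ f′ ⊕ g′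
  ⊕-cong f≋f′ g≋g′ n = +-cong (f≋f′ n) (g≋g′ n)

  •-congˡ : ∀ a {f g} → f ≋ g → a • f ≋ a • g
  •-congˡ a f≋g n = *-congˡ (f≋g n)

  shift-cong : ∀ {f g} → f ≋ g → shift f ≋ shift g
  shift-cong f≋g zero    = refl
  shift-cong f≋g (suc n) = f≋g n

  dilate-cong : ∀ q {f g} → f ≋ g → dilate q f ≋ dilate q g
  dilate-cong q f≋g n = *-congˡ (f≋g n)

  ⊙-cong : ∀ {f f′ g g′} → f ≋ f′ → g ≋ g′ → f ⊙ g ≋ f′ ⊙ g′
  ⊙-cong f≋f′ g≋g′ zero    = *-cong (f≋f′ 0) (g≋g′ 0)
  ⊙-cong f≋f′ g≋g′ (suc n) =
    +-cong (*-cong (f≋f′ 0) (g≋g′ (suc n))) (⊙-cong (λ k → f≋f′ (suc k)) g≋g′ n)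

  ⊙-congˡ-upTo : ∀ f {g h} n → (∀ k → k ≤ n → g k ≈ h k) → (f ⊙ g) n ≈ (f ⊙ h) n
  ⊙-congˡ-upTo f zero    g≈h = *-congˡ (g≈h 0 z≤n)
  ⊙-congˡ-upTo f (suc n) g≈h =
    +-cong (*-congˡ (g≈h (suc n) ≤-refl))
           (⊙-congˡ-upTo (tail f) n (λ k k≤n → g≈h k (m≤n⇒m≤1+n k≤n)))

  private
    interchange : ∀ a b c d → (a + b) + (c + d) ≈ (a + c) + (b + d)
    interchange = solve 4 (λ a b c d → (a :+ b) :+ (c :+ d) := (a :+ c) :+ (b :+ d)) refl

  ⊙-distribʳ-⊕ : ∀ f g h → (f ⊕ g) ⊙ h ≋ f ⊙ h ⊕ g ⊙ h
  ⊙-distribʳ-⊕ f g h zero    = distribʳ (h 0) (f 0) (g 0)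
  ⊙-distribʳ-⊕ f g h (suc n) =
    trans (+-cong (distribʳ (h (suc n)) (f 0) (g 0)) (⊙-distribʳ-⊕ (tail f) (tail g) h n))
          (interchange _ _ _ _)

  ⊙-distribˡ-⊕ : ∀ f g h → f ⊙ (g ⊕ h) ≋ f ⊙ g ⊕ f ⊙ h
  ⊙-distribˡ-⊕ f g h zero    = distribˡ (f 0) (g 0) (h 0)
  ⊙-distribˡ-⊕ f g h (suc n) =
    trans (+-cong (distribˡ (f 0) (g (suc n)) (h (suc n))) (⊙-distribˡ-⊕ (tail f) g h n))
          (interchange _ _ _ _)

  •-⊙-assoc : ∀ a f g → (a • f) ⊙ g ≋ a • (f ⊙ g)
  •-⊙-assoc a f g zero    = *-assoc a (f 0) (g 0)
  •-⊙-assoc a f g (suc n) =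
    trans (+-congˡ (•-⊙-assoc a (tail f) g n))
          (solve 4 (λ a f g m → a :* f :* g :+ a :* m := a :* (f :* g :+ m)) refl
                 a (f 0) (g (suc n)) _)

  ⊙-•-assoc : ∀ a f g → f ⊙ (a • g) ≋ a • (f ⊙ g)
  ⊙-•-assoc a f g zero    = solve 3 (λ a f g → f :* (a :* g) := a :* (f :* g)) refl a (f 0) (g 0)
  ⊙-•-assoc a f g (suc n) =
    trans (+-congˡ (⊙-•-assoc a (tail f) g n))
          (solve 4 (λ a f g m → f :* (a :* g) :+ a :* m := a :* (f :* g :+ m)) refl
                 a (f 0) (g (suc n)) _)

  ⊙-distribˡ-combination : ∀ f a b d F G H →
    f ⊙ (a • F ⊕ b • G ⊕ d • H) ≋ a • (f ⊙ F) ⊕ b • (f ⊙ G) ⊕ d • (f ⊙ H)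
  ⊙-distribˡ-combination f a b d F G H = begin
    f ⊙ (a • F ⊕ b • G ⊕ d • H)
      ≈⟨ ⊙-distribˡ-⊕ f (a • F ⊕ b • G) (d • H) ⟩
    f ⊙ (a • F ⊕ b • G) ⊕ f ⊙ (d • H)
      ≈⟨ ⊕-cong (⊙-distribˡ-⊕ f (a • F) (b • G)) ≋-refl ⟩
    f ⊙ (a • F) ⊕ f ⊙ (b • G) ⊕ f ⊙ (d • H)
      ≈⟨ ⊕-cong (⊕-cong (⊙-•-assoc a f F) (⊙-•-assoc b f G)) (⊙-•-assoc d f H) ⟩
    a • (f ⊙ F) ⊕ b • (f ⊙ G) ⊕ d • (f ⊙ H)
      ∎
    where open SetoidReasoning ≋-setoid

  ⊙-suc-tailʳ : ∀ f g n → (f ⊙ g) (suc n) ≈ f (suc n) * g 0 + (f ⊙ tail g) n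
  ⊙-suc-tailʳ f g zero    = +-comm _ _
  ⊙-suc-tailʳ f g (suc n) =
    trans (+-congˡ (⊙-suc-tailʳ (tail f) g n))
          (solve 3 (λ a b c → a :+ (b :+ c) := b :+ (a :+ c)) refl _ _ _)

  ⊙-comm : ∀ f g → f ⊙ g ≋ g ⊙ f
  ⊙-comm f g zero    = *-comm (f 0) (g 0)
  ⊙-comm f g (suc n) =
    trans (+-cong (*-comm (f 0) (g (suc n))) (⊙-comm (tail f) g n)) (sym (⊙-suc-tailʳ g f n))

  ⊙-assoc : ∀ f g h → (f ⊙ g) ⊙ h ≋ f ⊙ (g ⊙ h)
  ⊙-assoc f g h zero    = *-assoc (f 0) (g 0) (h 0)
  ⊙-assoc f g h (suc n) = begin
    (f 0 * g 0) * h (suc n) + ((f 0 • tail g ⊕ tail f ⊙ g) ⊙ h) n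
      ≈⟨ +-congˡ (⊙-distribʳ-⊕ (f 0 • tail g) (tail f ⊙ g) h n) ⟩
    (f 0 * g 0) * h (suc n) + (((f 0 • tail g) ⊙ h) n + ((tail f ⊙ g) ⊙ h) n)
      ≈⟨ +-congˡ (+-cong (•-⊙-assoc (f 0) (tail g) h n) (⊙-assoc (tail f) g h n)) ⟩
    (f 0 * g 0) * h (suc n) + (f 0 * (tail g ⊙ h) n + (tail f ⊙ (g ⊙ h)) n)
      ≈⟨ solve 5 (λ a b c m r → (a :* b) :* c :+ (a :* m :+ r) := a :* (b :* c :+ m) :+ r) refl
               (f 0) (g 0) (h (suc n)) _ _ ⟩
    f 0 * (g ⊙ h) (suc n) + (tail f ⊙ (g ⊙ h)) n
      ∎
    where open SetoidReasoning setoid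

  ⊙-shiftʳ : ∀ f g → f ⊙ shift g ≋ shift (f ⊙ g)
  ⊙-shiftʳ f g zero    = zeroʳ (f 0)
  ⊙-shiftʳ f g (suc n) = trans (+-congˡ (⊙-shiftʳ (tail f) g n)) (head-step n)
    where
    head-step : ∀ n → f 0 * g n + shift (tail f ⊙ g) n ≈ shift (f ⊙ g) (suc n)
    head-step zero    = +-identityʳ _
    head-step (suc n) = refl

  ⊙-shiftˡ : ∀ f g → shift f ⊙ g ≋ shift (f ⊙ g)
  ⊙-shiftˡ f g n =
    trans (⊙-comm (shift f) g n) (trans (⊙-shiftʳ g f n) (shift-cong (⊙-comm g f) n))

  𝟙-⊙ : ∀ f → 𝟙 ⊙ f ≋ f
  𝟙-⊙ f zero    = *-identityˡ (f 0)
  𝟙-⊙ f (suc n) = trans (+-cong (*-identityˡ _) (zero-⊙ n)) (+-identityʳ _)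
    where
    zero-⊙ : ∀ n → (tail 𝟙 ⊙ f) n ≈ 0#
    zero-⊙ zero    = zeroˡ (f 0)
    zero-⊙ (suc n) = trans (+-cong (zeroˡ _) (zero-⊙ n)) (+-identityʳ 0#)

  ⊙-𝟙 : ∀ f → f ⊙ 𝟙 ≋ f
  ⊙-𝟙 f n = trans (⊙-comm f 𝟙 n) (𝟙-⊙ f n)

  dilate-⊙ : ∀ q f g → dilate q f ⊙ dilate q g ≋ dilate q (f ⊙ g)
  dilate-⊙ q f g zero    = trans (*-cong (*-identityˡ (f 0)) (*-identityˡ (g 0))) (sym (*-identityˡ _))
  dilate-⊙ q f g (suc n) = begin
    (1# * f 0) * dilate q g (suc n) + (tail (dilate q f) ⊙ dilate q g) n
      ≈⟨ +-cong (*-congʳ (*-identityˡ (f 0)))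
                (⊙-cong (λ k → *-assoc q (pow q k) (f (suc k))) (λ _ → refl) n) ⟩
    f 0 * dilate q g (suc n) + ((q • dilate q (tail f)) ⊙ dilate q g) n
      ≈⟨ +-congˡ (trans (•-⊙-assoc q (dilate q (tail f)) (dilate q g) n)
                        (*-congˡ (dilate-⊙ q (tail f) g n))) ⟩
    f 0 * ((q * pow q n) * g (suc n)) + q * (pow q n * (tail f ⊙ g) n)
      ≈⟨ solve 5 (λ f q p g m → f :* ((q :* p) :* g) :+ q :* (p :* m) := (q :* p) :* (f :* g :+ m))
               refl (f 0) q (pow q n) (g (suc n)) _ ⟩
    dilate q (f ⊙ g) (suc n)
      ∎
    where open SetoidReasoning setoid

  sumBelow-cong : ∀ m {F G : ℕ → Carrier} →
                  (∀ k → k < m → F k ≈ G k) → sumBelow m F ≈ sumBelow m G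
  sumBelow-cong zero    F≈G = refl
  sumBelow-cong (suc m) F≈G =
    +-cong (sumBelow-cong m (λ k k<m → F≈G k (m≤n⇒m≤1+n k<m))) (F≈G m ≤-refl)

  ⊙-sumBelow : ∀ f g n → sumBelow (suc n) (λ k → f (n ∸ k) * g k) ≈ (f ⊙ g) n
  ⊙-sumBelow f g zero    = +-identityˡ _
  ⊙-sumBelow f g (suc n) =
    trans (+-cong (trans (sumBelow-cong (suc n) reindex) (⊙-sumBelow (tail f) g n))
                  (*-congʳ (reflexive (≡.cong f (n∸n≡0 n)))))
          (+-comm _ _)
    where
    reindex : ∀ k → k < suc n → f (suc n ∸ k) * g k ≈ tail f (n ∸ k) * g k
    reindex k (s≤s k≤n) = *-congʳ (reflexive (≡.cong f (+-∸-assoc 1 k≤n)))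

  ⊙-cancelˡ : ∀ f {g h} → f 0 ≈ 1# → f ⊙ g ≋ f ⊙ h → g ≋ h
  ⊙-cancelˡ f {g} {h} f₀≈1 fg≋fh = <-rec (λ n → g n ≈ h n) step
    where
    cancel-f₀ : ∀ {x y} → f 0 * x ≈ f 0 * y → x ≈ y
    cancel-f₀ {x} {y} f₀x≈f₀y = begin
      x         ≈⟨ *-identityˡ x ⟨
      1# * x    ≈⟨ *-congʳ f₀≈1 ⟨
      f 0 * x   ≈⟨ f₀x≈f₀y ⟩
      f 0 * y   ≈⟨ *-congʳ f₀≈1 ⟩
      1# * y    ≈⟨ *-identityˡ y ⟩
      y         ∎
      where open SetoidReasoning setoid
    step : ∀ n → (∀ {k} → k < n → g k ≈ h k) → g n ≈ h n
    step zero    _   = cancel-f₀ (fg≋fh 0)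
    step (suc n) IH  = cancel-f₀ (+-cancelʳ _ _ _ (trans (fg≋fh (suc n))
      (+-congˡ (sym (⊙-congˡ-upTo (tail f) n (λ k k≤n → IH (s≤s k≤n)))))))

module ThetaCoefficients {r ℓ : Level} (K : Field r ℓ) where
  open Field K
  open FieldDefs K
  open FieldProperties K
  open PowerSeries K
  open RingProperties ring using (+-cancelʳ)
  open NaturalCoefficients commutativeSemiring using (solve; _:=_; _:+_; _:*_)

  thetaCoeff-zero : ∀ q a → thetaCoeff q a 0 ≈ 1#
  thetaCoeff-zero q a = inverse (1# * 1#) (*-≉0 1≉0 1≉0)

  qPoch-≉0 : ∀ {a q} → (∀ k → ¬ 1# - a * pow q k ≈ 0#) → ∀ n → ¬ qPoch a q n ≈ 0#
  qPoch-≉0 factor≉0 zero    = 1≉0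
  qPoch-≉0 factor≉0 (suc n) = *-≉0 (qPoch-≉0 factor≉0 n) (factor≉0 n)

  -- both sides are (a;q)_{n+1}
  qPoch-shift : ∀ a q n → (1# - a) * qPoch (a * q) q n ≈ qPoch a q n * (1# - a * pow q n)
  qPoch-shift a q zero    = begin
    (1# - a) * 1#        ≈⟨ *-identityʳ (1# - a) ⟩
    1# - a               ≈⟨ +-congˡ (-‿cong (*-identityʳ a)) ⟨
    1# - a * 1#          ≈⟨ *-identityˡ (1# - a * 1#) ⟨
    1# * (1# - a * 1#)   ∎
    where open SetoidReasoning setoid
  qPoch-shift a q (suc n) = begin
    (1# - a) * (qPoch (a * q) q n * (1# - a * q * pow q n))
      ≈⟨ *-assoc (1# - a) _ _ ⟨
    (1# - a) * qPoch (a * q) q n * (1# - a * q * pow q n)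
      ≈⟨ *-cong (qPoch-shift a q n) (+-congˡ (-‿cong (*-assoc a q (pow q n)))) ⟩
    qPoch a q n * (1# - a * pow q n) * (1# - a * pow q (suc n))
      ∎
    where open SetoidReasoning setoid

  pow-2*-suc : ∀ x m → pow x (2 ℕ.* suc m) ≈ x * (x * pow x (2 ℕ.* m))
  pow-2*-suc x m = *-congˡ (reflexive (≡.cong (pow x) (+-suc m (m ℕ.+ 0))))

  module Generic
    (q t : Carrier)
    (q-generic : ∀ k → k ≥ 1 → ¬ (1# - pow q k ≈ 0#))
    (t-generic : ∀ k → k ≥ 1 → ¬ (1# - t * pow q k ≈ 0#))
    where

    s : Carrier
    s = t * q

    u c : Carrier
    u = 1# - s
    c = 1# - q

    θ θ₊ : Series
    θ  = thetaCoeff q t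
    θ₊ = thetaCoeff q s

    qNum-suc : ∀ n → qNum q t (suc n) ≈ (1# - s * pow q n) * c ⁻¹
    qNum-suc n = *-congʳ (+-congˡ (-‿cong (sym (*-assoc t q (pow q n)))))

    qNum-one : qNum q t 1 ≈ u * c ⁻¹
    qNum-one = trans (qNum-suc 0) (*-congʳ (+-congˡ (-‿cong (*-identityʳ s))))

    private
      N : ℕ → Carrier
      N n = pow (- 1#) n * pow c (2 ℕ.* n)

      qPoch-q≉0 : ∀ n → ¬ qPoch q q n ≈ 0#
      qPoch-q≉0 = qPoch-≉0 (λ k → q-generic (suc k) (s≤s z≤n))

      qPoch-s≉0 : ∀ n → ¬ qPoch s q n ≈ 0#
      qPoch-s≉0 = qPoch-≉0 (λ k →
        ≉0-resp-≈ (+-congˡ (-‿cong (sym (*-assoc t q (pow q k))))) (t-generic (suc k) (s≤s z≤n)))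

      qPoch-sq≉0 : ∀ n → ¬ qPoch (s * q) q n ≈ 0#
      qPoch-sq≉0 = qPoch-≉0 (λ k →
        ≉0-resp-≈ (+-congˡ (-‿cong (reassoc t q (pow q k)))) (t-generic (suc (suc k)) (s≤s z≤n)))
        where
        reassoc : ∀ t q p → t * (q * (q * p)) ≈ t * q * q * p
        reassoc = solve 3 (λ t q p → t :* (q :* (q :* p)) := t :* q :* q :* p) refl

      D D₊ : ℕ → Carrier
      D  n = qPoch q q n * qPoch s q n
      D₊ n = qPoch q q n * qPoch (s * q) q n

      D≉0 : ∀ n → ¬ D n ≈ 0#
      D≉0 n = *-≉0 (qPoch-q≉0 n) (qPoch-s≉0 n)

      D₊≉0 : ∀ n → ¬ D₊ n ≈ 0#
      D₊≉0 n = *-≉0 (qPoch-q≉0 n) (qPoch-sq≉0 n)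

    thetaCoeff-contiguous : ∀ n → u * θ n ≈ (1# - s * pow q n) * θ₊ n
    thetaCoeff-contiguous n = begin
      u * (N n * D n ⁻¹)   ≈⟨ *-assoc u (N n) _ ⟨
      u * N n * D n ⁻¹     ≈⟨ cross-multiply (D≉0 n) (D₊≉0 n) cleared ⟩
      v * N n * D₊ n ⁻¹    ≈⟨ *-assoc v (N n) _ ⟩
      v * (N n * D₊ n ⁻¹)  ∎
      where
      open SetoidReasoning setoid
      v : Carrier
      v = 1# - s * pow q n
      cleared : u * N n * D₊ n ≈ v * N n * D n
      cleared = begin
        u * N n * (qPoch q q n * qPoch (s * q) q n)
          ≈⟨ solve 4 (λ u N P R → u :* N :* (P :* R) := N :* P :* (u :* R)) refl
                   u (N n) (qPoch q q n) (qPoch (s * q) q n) ⟩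
        N n * qPoch q q n * (u * qPoch (s * q) q n)
          ≈⟨ *-congˡ (qPoch-shift s q n) ⟩
        N n * qPoch q q n * (qPoch s q n * v)
          ≈⟨ solve 4 (λ N P R v → N :* P :* (R :* v) := v :* N :* (P :* R)) refl
                   (N n) (qPoch q q n) (qPoch s q n) v ⟩
        v * N n * D n
          ∎

    thetaCoeff-q-difference :
      ∀ m → u * ((pow q (suc m) - 1#) * θ (suc m)) ≈ c * c * θ₊ m
    thetaCoeff-q-difference m = begin
      u * (w * (N (suc m) * D (suc m) ⁻¹))
        ≈⟨ solve 4 (λ u w N Di → u :* (w :* (N :* Di)) := u :* w :* N :* Di) refl
                 u w (N (suc m)) (D (suc m) ⁻¹) ⟩
      u * w * N (suc m) * D (suc m) ⁻¹
        ≈⟨ cross-multiply (D≉0 (suc m)) (D₊≉0 m) cleared ⟩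
      c * c * N m * D₊ m ⁻¹
        ≈⟨ *-assoc (c * c) (N m) _ ⟩
      c * c * (N m * D₊ m ⁻¹)
        ∎
      where
      open SetoidReasoning setoid
      Q w S C : Carrier
      Q = pow q (suc m)
      w = Q - 1#
      S = pow (- 1#) m
      C = pow c (2 ℕ.* m)
      cleared : u * w * N (suc m) * D₊ m ≈ c * c * N m * D (suc m)
      cleared = begin
        u * w * (- 1# * S * pow c (2 ℕ.* suc m)) * (qPoch q q m * qPoch (s * q) q m)
          ≈⟨ *-congʳ (*-congˡ (*-congˡ (pow-2*-suc c m))) ⟩
        u * w * (- 1# * S * (c * (c * C))) * (qPoch q q m * qPoch (s * q) q m)
          ≈⟨ solve 8 (λ u w m1 S c C P R → u :* w :* (m1 :* S :* (c :* (c :* C))) :* (P :* R)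
                                           := c :* c :* (S :* C) :* (P :* (w :* m1) :* (u :* R)))
                   refl u w (- 1#) S c C (qPoch q q m) (qPoch (s * q) q m) ⟩
        c * c * N m * (qPoch q q m * (w * - 1#) * (u * qPoch (s * q) q m))
          ≈⟨ *-congˡ (*-cong (*-congˡ ([x-1]*-1≈1-x Q)) (qPoch-shift s q m)) ⟩
        c * c * N m * D (suc m)
          ∎

    contiguity : u • θ ⊕ s • dilate q θ₊ ≋ θ₊
    contiguity n = begin
      u * θ n + s * (pow q n * θ₊ n)
        ≈⟨ +-cong (thetaCoeff-contiguous n) (sym (*-assoc s (pow q n) (θ₊ n))) ⟩
      (1# - s * pow q n) * θ₊ n + s * pow q n * θ₊ n
        ≈⟨ [1-x]*y+x*y≈y (s * pow q n) (θ₊ n) ⟩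
      θ₊ n
        ∎
      where open SetoidReasoning setoid

    q-difference : (c * c) • shift θ₊ ⊕ u • θ ≋ u • dilate q θ
    q-difference zero    =
      trans (+-cong (zeroʳ (c * c)) (*-congˡ (sym (*-identityˡ (θ 0))))) (+-identityˡ _)
    q-difference (suc m) = begin
      c * c * θ₊ m + u * θ (suc m)
        ≈⟨ +-congʳ (thetaCoeff-q-difference m) ⟨
      u * ((pow q (suc m) - 1#) * θ (suc m)) + u * θ (suc m)
        ≈⟨ distribˡ u _ _ ⟨
      u * ((pow q (suc m) - 1#) * θ (suc m) + θ (suc m))
        ≈⟨ *-congˡ ([x-1]*y+y≈x*y (pow q (suc m)) (θ (suc m))) ⟩
      u * (pow q (suc m) * θ (suc m))
        ∎
      where open SetoidReasoning setoid

    module Quotient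
      (q≉0 : ¬ q ≈ 0#) (t≉0 : ¬ t ≈ 0#)
      (μ : Series) (θ⊙μ≋θ₊ : θ ⊙ μ ≋ θ₊)
      where

      P : Series
      P = dilate q μ

      s≉0 : ¬ s ≈ 0#
      s≉0 = *-≉0 t≉0 q≉0

      c≉0 : ¬ c ≈ 0#
      c≉0 = ≉0-resp-≈ (+-congˡ (-‿cong (*-identityʳ q))) (q-generic 1 (s≤s z≤n))

      μ-zero : μ 0 ≈ 1#
      μ-zero = begin
        μ 0        ≈⟨ *-identityˡ (μ 0) ⟨
        1# * μ 0   ≈⟨ *-congʳ (thetaCoeff-zero q t) ⟨
        θ 0 * μ 0  ≈⟨ θ⊙μ≋θ₊ 0 ⟩
        θ₊ 0       ≈⟨ thetaCoeff-zero q s ⟩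
        1#         ∎
        where open SetoidReasoning setoid

      dilated-product : u • (θ ⊙ P) ⊕ (c * c) • shift (θ₊ ⊙ P) ≋ u • dilate q θ₊
      dilated-product = begin
        u • (θ ⊙ P) ⊕ (c * c) • shift (θ₊ ⊙ P)
          ≈⟨ ⊕-cong (•-⊙-assoc u θ P) (λ n → trans (•-⊙-assoc (c * c) (shift θ₊) P n)
                                                  (*-congˡ (⊙-shiftˡ θ₊ P n))) ⟨
        (u • θ) ⊙ P ⊕ ((c * c) • shift θ₊) ⊙ P
          ≈⟨ ⊙-distribʳ-⊕ (u • θ) ((c * c) • shift θ₊) P ⟨
        (u • θ ⊕ (c * c) • shift θ₊) ⊙ P
          ≈⟨ ⊙-cong (λ n → trans (+-comm _ _) (q-difference n)) (λ _ → refl) ⟩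
        (u • dilate q θ) ⊙ P
          ≈⟨ •-⊙-assoc u (dilate q θ) P ⟩
        u • (dilate q θ ⊙ dilate q μ)
          ≈⟨ •-congˡ u (dilate-⊙ q θ μ) ⟩
        u • dilate q (θ ⊙ μ)
          ≈⟨ •-congˡ u (dilate-cong q θ⊙μ≋θ₊) ⟩
        u • dilate q θ₊
          ∎
        where open SetoidReasoning ≋-setoid

      shift-θ₊⊙P : shift (θ₊ ⊙ P) ≋ θ ⊙ shift (μ ⊙ P)
      shift-θ₊⊙P = begin
        shift (θ₊ ⊙ P)         ≈⟨ shift-cong (⊙-cong θ⊙μ≋θ₊ ≋-refl) ⟨
        shift ((θ ⊙ μ) ⊙ P)    ≈⟨ shift-cong (⊙-assoc θ μ P) ⟩
        shift (θ ⊙ (μ ⊙ P))    ≈⟨ ⊙-shiftʳ θ (μ ⊙ P) ⟨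
        θ ⊙ shift (μ ⊙ P)      ∎
        where open SetoidReasoning ≋-setoid

      q-riccati :
        u • μ ≋ (s * u) • P ⊕ (s * (c * c)) • shift (μ ⊙ P) ⊕ (u * u) • 𝟙
      q-riccati = ⊙-cancelˡ θ (thetaCoeff-zero q t) (begin
        θ ⊙ (u • μ)
          ≈⟨ ⊙-•-assoc u θ μ ⟩
        u • (θ ⊙ μ)
          ≈⟨ •-congˡ u (≋-trans θ⊙μ≋θ₊ (≋-sym contiguity)) ⟩
        u • (u • θ ⊕ s • dilate q θ₊)
          ≈⟨ (λ n → solve 4 (λ u s a b → u :* (u :* a :+ s :* b)
                                      := s :* (u :* b) :+ u :* u :* a)
                             refl u s (θ n) (dilate q θ₊ n)) ⟩
        s • (u • dilate q θ₊) ⊕ (u * u) • θ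
          ≈⟨ ⊕-cong (•-congˡ s dilated-product) (•-congˡ (u * u) (⊙-𝟙 θ)) ⟨
        s • (u • (θ ⊙ P) ⊕ (c * c) • shift (θ₊ ⊙ P)) ⊕ (u * u) • (θ ⊙ 𝟙)
          ≈⟨ (λ n → +-congʳ (solve 5 (λ s u x cc y → s :* (u :* x :+ cc :* y)
                                                   := s :* u :* x :+ s :* cc :* y)
                                     refl s u ((θ ⊙ P) n) (c * c) (shift (θ₊ ⊙ P) n))) ⟩
        (s * u) • (θ ⊙ P) ⊕ (s * (c * c)) • shift (θ₊ ⊙ P) ⊕ (u * u) • (θ ⊙ 𝟙)
          ≈⟨ ⊕-cong (⊕-cong ≋-refl (•-congˡ (s * (c * c)) shift-θ₊⊙P)) ≋-refl ⟩
        (s * u) • (θ ⊙ P) ⊕ (s * (c * c)) • (θ ⊙ shift (μ ⊙ P)) ⊕ (u * u) • (θ ⊙ 𝟙)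
          ≈⟨ ⊙-distribˡ-combination θ (s * u) (s * (c * c)) (u * u) P (shift (μ ⊙ P)) 𝟙 ⟨
        θ ⊙ ((s * u) • P ⊕ (s * (c * c)) • shift (μ ⊙ P) ⊕ (u * u) • 𝟙)
          ∎)
        where open SetoidReasoning ≋-setoid

      cleared-recurrence : ∀ m →
        u * (1# - s * pow q (suc m)) * μ (suc m) ≈ s * (c * c) * (μ ⊙ P) m
      cleared-recurrence m = +-cancelʳ (s * u * (Q * μ′)) _ _ (begin
        u * (1# - s * Q) * μ′ + s * u * (Q * μ′)
          ≈⟨ solve 5 (λ u v μ′ s Q → u :* v :* μ′ :+ s :* u :* (Q :* μ′)
                                    := u :* (v :* μ′ :+ s :* Q :* μ′))
                   refl u (1# - s * Q) μ′ s Q ⟩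
        u * ((1# - s * Q) * μ′ + s * Q * μ′)
          ≈⟨ *-congˡ ([1-x]*y+x*y≈y (s * Q) μ′) ⟩
        u * μ′
          ≈⟨ q-riccati (suc m) ⟩
        s * u * (Q * μ′) + s * (c * c) * (μ ⊙ P) m + u * u * 0#
          ≈⟨ trans (+-congˡ (zeroʳ (u * u))) (+-identityʳ _) ⟩
        s * u * (Q * μ′) + s * (c * c) * (μ ⊙ P) m
          ≈⟨ +-comm _ _ ⟩
        s * (c * c) * (μ ⊙ P) m + s * u * (Q * μ′)
          ∎)
        where
        open SetoidReasoning setoid
        Q μ′ : Carrier
        Q  = pow q (suc m)
        μ′ = μ (suc m)

      sumBelow-≈-μ⊙P : ∀ m →
        sumBelow (suc m) (λ k → pow q k * μ k * μ (suc m ∸ k ∸ 1)) ≈ (μ ⊙ P) m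
      sumBelow-≈-μ⊙P m = trans (sumBelow-cong (suc m) reindex) (⊙-sumBelow μ P m)
        where
        reindex : ∀ k → k < suc m → pow q k * μ k * μ (suc m ∸ k ∸ 1) ≈ μ (m ∸ k) * P k
        reindex k (s≤s k≤m) =
          trans (*-congˡ (reflexive (≡.cong (λ j → μ (j ∸ 1)) (+-∸-assoc 1 k≤m)))) (*-comm _ _)

      recurrence : ∀ n → n ≥ 1 →
        s ⁻¹ * qNum q t 1 * qNum q t (suc n) * μ n
          ≈ sumBelow n (λ k → pow q k * μ k * μ (n ∸ k ∸ 1))
      recurrence (suc m) _ = begin
        s ⁻¹ * qNum q t 1 * qNum q t (suc (suc m)) * μ (suc m)
          ≈⟨ *-congʳ (*-cong (*-congˡ qNum-one) (qNum-suc (suc m))) ⟩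
        s ⁻¹ * (u * c ⁻¹) * ((1# - s * Q) * c ⁻¹) * μ (suc m)
          ≈⟨ solve 5 (λ si u ci v μ′ → si :* (u :* ci) :* (v :* ci) :* μ′
                                      := si :* (ci :* (ci :* (u :* v :* μ′))))
                   refl (s ⁻¹) u (c ⁻¹) (1# - s * Q) (μ (suc m)) ⟩
        s ⁻¹ * (c ⁻¹ * (c ⁻¹ * (u * (1# - s * Q) * μ (suc m))))
          ≈⟨ *-congˡ (*-congˡ (*-congˡ (cleared-recurrence m))) ⟩
        s ⁻¹ * (c ⁻¹ * (c ⁻¹ * (s * (c * c) * Y)))
          ≈⟨ solve 5 (λ si ci s c Y → si :* (ci :* (ci :* (s :* (c :* c) :* Y)))
                                      := si :* (s :* (ci :* (c :* (ci :* (c :* Y))))))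
                   refl (s ⁻¹) (c ⁻¹) s c Y ⟩
        s ⁻¹ * (s * (c ⁻¹ * (c * (c ⁻¹ * (c * Y)))))
          ≈⟨ ⁻¹-cancelˡ s≉0 _ ⟩
        c ⁻¹ * (c * (c ⁻¹ * (c * Y)))
          ≈⟨ ⁻¹-cancelˡ c≉0 _ ⟩
        c ⁻¹ * (c * Y)
          ≈⟨ ⁻¹-cancelˡ c≉0 Y ⟩
        Y
          ≈⟨ sumBelow-≈-μ⊙P m ⟨
        sumBelow (suc m) (λ k → pow q k * μ k * μ (suc m ∸ k ∸ 1))
          ∎
        where
        open SetoidReasoning setoid
        Q Y : Carrier
        Q = pow q (suc m)
        Y = (μ ⊙ P) m

proposition3p3 :
  ∀ {c ℓ : Level} (K : Field c ℓ) →
    let open Field K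
        open FieldDefs K
    in (q t : Carrier) →
       -- q ≠ 0, t = q^ν ≠ 0, q not a root of unity, ν not a negative integer
       ¬ (q ≈ 0#) → ¬ (t ≈ 0#) →
       (∀ k → k ≥ 1 → ¬ (1# - pow q k ≈ 0#)) →
       (∀ k → k ≥ 1 → ¬ (1# - t * pow q k ≈ 0#)) →
       (μ : ℕ → Carrier) →
       -- θ_ν(x) · Σ μ_n x^n = θ_{ν+1}(x), coefficientwise
       (∀ n → sumBelow (suc n) (λ k → thetaCoeff q t (n ∸ k) * μ k)
                ≈ thetaCoeff q (t * q) n) →
       (μ 0 ≈ 1#) ×
       (∀ n → n ≥ 1 →
          ((t * q) ⁻¹) * qNum q t 1 * qNum q t (suc n) * μ n
            ≈ sumBelow n (λ k → pow q k * μ k * μ (n ∸ k ∸ 1)))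
proposition3p3 K q t q≉0 t≉0 q-generic t-generic μ θμ≈θ₊ = μ-zero , recurrence
  where
  open Field K
  open FieldDefs K using (thetaCoeff)
  open PowerSeries K using (_⊙_; _≋_; ⊙-sumBelow)

  θ⊙μ≋θ₊ : thetaCoeff q t ⊙ μ ≋ thetaCoeff q (t * q)
  θ⊙μ≋θ₊ n = trans (sym (⊙-sumBelow (thetaCoeff q t) μ n)) (θμ≈θ₊ n)

  open ThetaCoefficients K
  open Generic q t q-generic t-generic
  open Quotient q≉0 t≉0 μ θ⊙μ≋θ₊
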